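{- Let $s$ be a $k\times k$ image. Then $\mathrm{Dist}(s,\mathcal C')\le \frac{k^2}{4}$.
   Context: A $k\times k$ image is a binary matrix of pixel values (1 = black, 0 = white). Its image graph has the black pixels as vertices, with edges between pixels at Manhattan distance 1. The border of $s$ consists of the pixels in its first or last row or first or last column. The image $s$ is border-connected if for every black pixel of $s$, the image graph of $s$ contains a path from that pixel to a (black) pixel on the border of $s$. $\mathcal C'$ denotes the set of border-connected $k\times k$ images, and $\mathrm{Dist}(s,\mathcal C')$ is the minimum number of pixels of $s$ that must be changed to obtain an image in $\mathcal C'$. -}

module Defs where

open import Data.Nat using (ℕ; zero; suc; _+_)
open import Data.Bool using (Bool; true; false; if_then_else_; _xor_)
open import Data.Fin using (Fin; toℕ)
open import Data.Product using (_×_; _,_; ∃; Σ)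
open import Data.Sum using (_⊎_)
open import Data.List using (List; map; allFin)
open import Data.Nat.ListAction using (sum)
open import Relation.Binary.PropositionalEquality using (_≡_)

Image : ℕ → Set
Image k = Fin k → Fin k → Bool

Pixel : ℕ → Set
Pixel k = Fin k × Fin k

Black : ∀ {k} → Image k → Pixel k → Set
Black s (i , j) = s i j ≡ true

Near : ∀ {k} → Fin k → Fin k → Set
Near a b = (suc (toℕ a) ≡ toℕ b) ⊎ (suc (toℕ b) ≡ toℕ a)

Adjacent : ∀ {k} → Pixel k → Pixel k → Set
Adjacent (i , j) (i' , j') = (i ≡ i' × Near j j') ⊎ (j ≡ j' × Near i i')

data Path {k : ℕ} (s : Image k) : Pixel k → Pixel k → Set where
  here : ∀ {p} → Black s p → Path s p p
  step : ∀ {p q r} → Black s p → Adjacent p q → Path s q r → Path s p r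

Extreme : ∀ {k} → Fin k → Set
Extreme {k} a = (toℕ a ≡ 0) ⊎ (suc (toℕ a) ≡ k)

OnBorder : ∀ {k} → Pixel k → Set
OnBorder (i , j) = Extreme i ⊎ Extreme j

BorderConnected : ∀ {k} → Image k → Set
BorderConnected {k} s =
  ∀ (p : Pixel k) → Black s p → Σ (Pixel k) (λ q → OnBorder q × Path s p q)

hamming : ∀ {k} → Image k → Image k → ℕ
hamming {k} s t =
  sum (map (λ i → sum (map (λ j → if s i j xor t i j then 1 else 0) (allFin k))) (allFin k))

{-# OPTIONS --safe #-}
-- Filling every third row (those with index ≡ r mod 3) makes an image border-connected:
-- each remaining row is on the border or next to a filled row, and filled rows run to
-- the border.  Together with the blank image this gives four border-connected
-- candidates, and every pixel is changed by at most one of them (a black pixel only by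
-- the blank image, a white pixel only by the filling of its own residue class).  The
-- four costs therefore sum to at most k², and the cheapest is at most k²/4.
module Submission where

open import Defs
open import Data.Nat using (ℕ; zero; suc; _+_; _*_; _≤_; _<_; z≤n; _≤?_)
open import Data.Nat.Properties
open import Algebra.Properties.CommutativeSemigroup +-commutativeSemigroup using (interchange)
open import Data.Bool using (Bool; true; false; _∨_; _xor_; if_then_else_)
open import Data.Bool.Properties using (∨-zeroʳ)
open import Data.Fin as Fin using (Fin; toℕ; fromℕ<)
open import Data.Fin.Properties using (toℕ-fromℕ<; toℕ<n)
open import Data.Product using (Σ; ∃; _×_; _,_)
open import Data.Sum using (_⊎_; inj₁; inj₂)
open import Data.List using (List; []; _∷_; map; allFin; length)
open import Data.List.Properties using (map-cong; length-tabulate)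
open import Data.List.Membership.Propositional using (_∈_)
open import Data.List.Relation.Unary.Any using (here; there)
open import Data.List.Relation.Unary.All as All using (All; _∷_)
open import Data.List.Relation.Unary.All.Properties using (map⁺)
open import Data.Nat.ListAction using (sum)
open import Data.Empty using (⊥-elim)
open import Relation.Binary.PropositionalEquality
  using (_≡_; _≢_; refl; sym; trans; cong; subst)
open import Relation.Nullary using (Dec; does; yes; no)
open import Relation.Nullary.Decidable using (dec-true)

private
  variable
    A B : Set
    k : ℕ

sum-map-+ : ∀ (f g : A → ℕ) xs → sum (map (λ x → f x + g x) xs) ≡ sum (map f xs) + sum (map g xs)
sum-map-+ f g []       = refl
sum-map-+ f g (x ∷ xs) = trans (cong (f x + g x +_) (sum-map-+ f g xs))
                               (interchange (f x) (g x) (sum (map f xs)) (sum (map g xs)))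

sum-map-zero : (xs : List A) → sum (map (λ _ → 0) xs) ≡ 0
sum-map-zero []       = refl
sum-map-zero (x ∷ xs) = sum-map-zero xs

sum-map-swap : ∀ (f : A → B → ℕ) xs ys →
  sum (map (λ x → sum (map (f x) ys)) xs) ≡ sum (map (λ y → sum (map (λ x → f x y) xs)) ys)
sum-map-swap f []       ys = sym (sum-map-zero ys)
sum-map-swap f (x ∷ xs) ys = trans (cong (sum (map (f x) ys) +_) (sum-map-swap f xs ys))
                                   (sym (sum-map-+ (f x) _ ys))

sum-map-≤ : ∀ {f : A → ℕ} {c} xs → (∀ x → f x ≤ c) → sum (map f xs) ≤ length xs * c
sum-map-≤ []       f≤c = z≤n
sum-map-≤ (x ∷ xs) f≤c = +-mono-≤ (f≤c x) (sum-map-≤ xs f≤c)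

∃-≤-average : (f : A → ℕ) (x : A) (xs : List A) →
  Σ A (λ y → y ∈ x ∷ xs × length (x ∷ xs) * f y ≤ sum (map f (x ∷ xs)))
∃-≤-average f x []       = x , here refl , ≤-refl
∃-≤-average f x (y ∷ ys) with ∃-≤-average f y ys
... | z , z∈ , avg with f x ≤? f z
...   | yes fx≤fz = x , here refl , +-monoʳ-≤ (f x) (≤-trans (*-monoʳ-≤ (length (y ∷ ys)) fx≤fz) avg)
...   | no  fx≰fz = z , there z∈ , +-mono-≤ (<⇒≤ (≰⇒> fx≰fz)) avg

mod3 : ℕ → Fin 3
mod3 0 = Fin.zero
mod3 1 = Fin.suc Fin.zero
mod3 2 = Fin.suc (Fin.suc Fin.zero)
mod3 (suc (suc (suc n))) = mod3 n

mod3-window : ∀ r n → mod3 n ≡ r ⊎ mod3 (suc n) ≡ r ⊎ mod3 (suc (suc n)) ≡ r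
mod3-window Fin.zero                     0 = inj₁ refl
mod3-window (Fin.suc Fin.zero)           0 = inj₂ (inj₁ refl)
mod3-window (Fin.suc (Fin.suc Fin.zero)) 0 = inj₂ (inj₂ refl)
mod3-window Fin.zero                     1 = inj₂ (inj₂ refl)
mod3-window (Fin.suc Fin.zero)           1 = inj₁ refl
mod3-window (Fin.suc (Fin.suc Fin.zero)) 1 = inj₂ (inj₁ refl)
mod3-window Fin.zero                     2 = inj₂ (inj₁ refl)
mod3-window (Fin.suc Fin.zero)           2 = inj₂ (inj₂ refl)
mod3-window (Fin.suc (Fin.suc Fin.zero)) 2 = inj₁ refl
mod3-window r (suc (suc (suc n))) = mod3-window r n

ReachesBorder : Image k → Pixel k → Set
ReachesBorder {k} t p = Σ (Pixel k) (λ q → OnBorder q × Path t p q)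

FullRow : Image k → Fin k → Set
FullRow t i = ∀ j → Black t (i , j)

fullRow⇒reachesBorder : {t : Image k} {i : Fin k} → FullRow t i → ∀ j → ReachesBorder t (i , j)
fullRow⇒reachesBorder {k} {t} {i} full j = walk (toℕ j) j refl
  where
  walk : ∀ n (j : Fin k) → toℕ j ≡ n → ReachesBorder t (i , j)
  walk zero    j j≡0   = (i , j) , inj₂ (inj₁ j≡0) , here (full j)
  walk (suc n) j j≡1+n =
    let n<k = <-trans (≤-reflexive (sym j≡1+n)) (toℕ<n j)
        q , q∈border , path = walk n (fromℕ< n<k) (toℕ-fromℕ< n<k)
        left = inj₂ (trans (cong suc (toℕ-fromℕ< n<k)) (sym j≡1+n))
    in q , q∈border , step (full j) (inj₁ (refl , left)) path

RowAnchored : Image k → Fin k → Set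
RowAnchored t i = Extreme i ⊎ FullRow t i ⊎ ∃ (λ i′ → Near i i′ × FullRow t i′)

rowsAnchored⇒borderConnected : {t : Image k} → (∀ i → RowAnchored t i) → BorderConnected t
rowsAnchored⇒borderConnected anchored (i , j) black with anchored i
... | inj₁ extreme                   = (i , j) , inj₁ extreme , here black
... | inj₂ (inj₁ full)               = fullRow⇒reachesBorder full j
... | inj₂ (inj₂ (i′ , near , full)) =
  let q , q∈border , path = fullRow⇒reachesBorder full j
  in q , q∈border , step black (inj₂ (refl , near)) path

blank : Image k
blank i j = false

blank-borderConnected : BorderConnected (blank {k})
blank-borderConnected p ()

fillRows : Fin 3 → Image k → Image k
fillRows r s i j = s i j ∨ does (mod3 (toℕ i) Fin.≟ r)

fillRows-fullRow : ∀ {r} (s : Image k) {i} → mod3 (toℕ i) ≡ r → FullRow (fillRows r s) i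
fillRows-fullRow {r = r} s {i} i≡r j =
  trans (cong (s i j ∨_) (dec-true (mod3 (toℕ i) Fin.≟ r) i≡r)) (∨-zeroʳ (s i j))

fillRows-rowAnchored : ∀ r (s : Image k) i → RowAnchored (fillRows r s) i
fillRows-rowAnchored {k} r s i = byResidue (mod3 (toℕ i) Fin.≟ r)
  where
  fullRowAt : ∀ n (n<k : n < k) → mod3 n ≡ r → FullRow (fillRows r s) (fromℕ< n<k)
  fullRowAt n n<k n≡r = fillRows-fullRow s (trans (cong mod3 (toℕ-fromℕ< n<k)) n≡r)

  unfilled : mod3 (toℕ i) ≢ r → ∀ n → toℕ i ≡ n → RowAnchored (fillRows r s) i
  unfilled i≢r zero    i≡0   = inj₁ (inj₁ i≡0)
  unfilled i≢r (suc m) i≡1+m with mod3-window r m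
  ... | inj₁ m≡r =
    let m<k = <-trans (n<1+n m) (subst (_< k) i≡1+m (toℕ<n i))
    in inj₂ (inj₂ (fromℕ< m<k , inj₂ (trans (cong suc (toℕ-fromℕ< m<k)) (sym i≡1+m))
                              , fullRowAt m m<k m≡r))
  ... | inj₂ (inj₁ 1+m≡r) = ⊥-elim (i≢r (trans (cong mod3 i≡1+m) 1+m≡r))
  ... | inj₂ (inj₂ 2+m≡r) with m≤n⇒m<n∨m≡n (subst (_< k) i≡1+m (toℕ<n i))
  ...   | inj₁ 2+m<k = inj₂ (inj₂ (fromℕ< 2+m<k , inj₁ (trans (cong suc i≡1+m) (sym (toℕ-fromℕ< 2+m<k)))
                                  , fullRowAt (suc (suc m)) 2+m<k 2+m≡r))
  ...   | inj₂ 2+m≡k = inj₁ (inj₂ (trans (cong suc i≡1+m) 2+m≡k))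

  byResidue : Dec (mod3 (toℕ i) ≡ r) → RowAnchored (fillRows r s) i
  byResidue (yes i≡r) = inj₂ (inj₁ (fillRows-fullRow s i≡r))
  byResidue (no  i≢r) = unfilled i≢r (toℕ i) refl

candidates : Image k → List (Image k)
candidates s = blank ∷ map (λ r → fillRows r s) (allFin 3)

candidates-borderConnected : (s : Image k) → All BorderConnected (candidates s)
candidates-borderConnected s =
  blank-borderConnected ∷ map⁺ (All.universal borderConnected (allFin 3))
  where
  borderConnected : ∀ r → BorderConnected (fillRows r s)
  borderConnected r = rowsAnchored⇒borderConnected (fillRows-rowAnchored r s)

-- hamming s t unfolds definitionally to the double sum of mismatch (s i j) (t i j).
mismatch : Bool → Bool → ℕ
mismatch a b = if a xor b then 1 else 0

mismatch-blankOrFill≤1 : ∀ b (c : Fin 3) →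
  mismatch b false + sum (map (λ r → mismatch b (b ∨ does (c Fin.≟ r))) (allFin 3)) ≤ 1
mismatch-blankOrFill≤1 true  c                            = ≤-refl
mismatch-blankOrFill≤1 false Fin.zero                     = ≤-refl
mismatch-blankOrFill≤1 false (Fin.suc Fin.zero)           = ≤-refl
mismatch-blankOrFill≤1 false (Fin.suc (Fin.suc Fin.zero)) = ≤-refl

candidates-mismatch≤1 : ∀ (s : Image k) i j →
  sum (map (λ t → mismatch (s i j) (t i j)) (candidates s)) ≤ 1
candidates-mismatch≤1 s i j = mismatch-blankOrFill≤1 (s i j) (mod3 (toℕ i))

sum-hamming-candidates≤ : (s : Image k) → sum (map (hamming s) (candidates s)) ≤ k * k
sum-hamming-candidates≤ {k} s = begin
  sum (map (hamming s) C)
    ≡⟨ sum-map-swap (λ t i → sum (map (λ j → mismatch (s i j) (t i j)) I)) C I ⟩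
  sum (map (λ i → sum (map (λ t → sum (map (λ j → mismatch (s i j) (t i j)) I)) C)) I)
    ≡⟨ cong sum (map-cong (λ i → sum-map-swap (λ t j → mismatch (s i j) (t i j)) C I) I) ⟩
  sum (map (λ i → sum (map (λ j → sum (map (λ t → mismatch (s i j) (t i j)) C)) I)) I)
    ≤⟨ sum-map-≤ I (λ i → sum-map-≤ I (candidates-mismatch≤1 s i)) ⟩
  length I * (length I * 1)
    ≡⟨ cong (λ n → n * (n * 1)) (length-tabulate {n = k} (λ i → i)) ⟩
  k * (k * 1)
    ≡⟨ cong (k *_) (*-identityʳ k) ⟩
  k * k ∎
  where
  open ≤-Reasoning
  C = candidates s
  I = allFin k

claim3p4 : (k : ℕ) (s : Image k) →
    Σ (Image k) (λ t → BorderConnected t × 4 * hamming s t ≤ k * k)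
claim3p4 k s =
  let t , t∈candidates , cheapest = ∃-≤-average (hamming s) blank (map (λ r → fillRows r s) (allFin 3))
  in t , All.lookup (candidates-borderConnected s) t∈candidates
       , ≤-trans cheapest (sum-hamming-candidates≤ s)
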